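{- Let $G=(V,E)$ be a connected chordal graph, and let $\pi$ be a sequence of rotations transforming a search tree $T$ on $G$ into a search tree $T'$ on $G$. Let $S\subseteq V$ be a convex subset. Let $\pi_{|S}$ be the sequence obtained from $\pi$ by removing every rotation that involves at least one vertex not in $S$. Then $\pi_{|S}$ is a sequence of rotations (on search trees on $G[S]$) that transforms $T_{|S}$ into $T'_{|S}$.
   Context: A search tree on a connected graph $G=(V,E)$ is a rooted tree with vertex set $V$ whose root is some $r\in V$ joined to the roots of search trees on each connected component of $G-r$. A rotation in a search tree $T$ involves a vertex $a$ and a child $b$ of $a$: letting $A$ be the vertex set of the subtree rooted at $a$, $b$ becomes the root of the subtree on $G[A]$, $a$ becomes the root of the subtree on the component of $G[A]-b$ containing $a$, and each subtree previously rooted at a child of $b$ is reattached to $a$ or to $b$ according to whether it lies in the same component of $G[A]-b$ as $a$ or not; the rest of the tree is unchanged. A vertex $v$ is simplicial if its neighbours form a clique. A set $S\subseteq V$ is convex if it is the set of vertices remaining after iteratively deleting vertices each of which is simplicial in the current remaining graph (i.e. after deleting a prefix of a perfect elimination ordering). In a chordal graph a simplicial vertex $v$ has at most one child in any search tree $T$; deleting $v$ from $T$ means: if $v$ is a leaf remove it; if $v$ is the root remove it and make its child the root; otherwise remove $v$ and join its parent to its child by an edge — the result is a search tree on $G-v$. The projection $T_{|S}$ is the search tree on $G[S]$ obtained by deleting, one at a time, the vertices of $V\setminus S$ in a simplicial elimination order (the result does not depend on the order chosen). -}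

module Defs where

open import Data.Nat using (ℕ; zero; suc; _+_; _≤_; _<_)
open import Data.Fin using (Fin; toℕ)
open import Data.Fin.Properties using (_≟_)
open import Data.Fin.Subset using (Subset; _∈_; _∉_; _─_; ⁅_⁆; ⊤)
open import Data.Fin.Subset.Properties using (_∈?_)
open import Data.Maybe using (Maybe; just; nothing)
open import Data.Product using (Σ; ∃; _×_; _,_)
open import Data.List using (List; []; _∷_; filter)
open import Relation.Nullary using (¬_; yes; no; Dec)
open import Relation.Nullary.Decidable using (_×-dec_)
open import Relation.Binary.PropositionalEquality using (_≡_; _≢_)
open import Function.Definitions using (Injective)

record Graph (n : ℕ) : Set₁ where
  field
    Adj    : Fin n → Fin n → Set
    sym    : ∀ {u v} → Adj u v → Adj v u
    irrefl : ∀ {u} → ¬ Adj u u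
open Graph public

module _ {n : ℕ} (G : Graph n) where

  data Walk (X : Fin n → Set) : Fin n → Fin n → Set where
    here : ∀ {u} → X u → Walk X u u
    step : ∀ {u w v} → X u → Adj G u w → Walk X w v → Walk X u v

  -- The induced subgraph G[X] is connected (vacuous if X is empty).
  Connected : (Fin n → Set) → Set
  Connected X = ∀ u v → X u → X v → Walk X u v

  IsComponent : (Fin n → Set) → (Fin n → Set) → Set
  IsComponent X C =
    (∀ u → C u → X u) ×
    (∃ λ u → C u) ×
    Connected C ×
    (∀ u w → C u → X w → Adj G u w → C w)

  -- Every cycle of length ≥ 4 has a chord.
  Chordal : Set
  Chordal = ∀ (k : ℕ) (c : Fin k → Fin n) → 4 ≤ k → Injective _≡_ _≡_ c →
    (∀ i j → toℕ j ≡ suc (toℕ i) → Adj G (c i) (c j)) →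
    (∀ i j → toℕ i ≡ 0 → suc (toℕ j) ≡ k → Adj G (c j) (c i)) →
    Σ (Fin k) λ i → Σ (Fin k) λ j →
      (suc (toℕ i) < toℕ j) × ¬ (toℕ i ≡ 0 × suc (toℕ j) ≡ k) × Adj G (c i) (c j)

  Simplicial : Subset n → Fin n → Set
  Simplicial R v = ∀ x y → x ∈ R → y ∈ R → x ≢ y →
    Adj G v x → Adj G v y → Adj G x y

  data IsElim : Subset n → List (Fin n) → Subset n → Set where
    done : ∀ {R} → IsElim R [] R
    elim : ∀ {R v ℓ S} → v ∈ R → Simplicial R v →
           IsElim (R ─ ⁅ v ⁆) ℓ S → IsElim R (v ∷ ℓ) S

  -- S is convex: obtained from V by deleting a prefix of a perfect elimination ordering.
  Convex : Subset n → Set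
  Convex S = ∃ λ ℓ → IsElim ⊤ ℓ S

-- A rooted tree (forest) is represented by its parent function.
Parent : ℕ → Set
Parent n = Fin n → Maybe (Fin n)

data Anc {n : ℕ} (p : Parent n) (a : Fin n) : Fin n → Set where
  self : Anc p a a
  up   : ∀ {v w} → p v ≡ just w → Anc p a w → Anc p a v

module _ {n : ℕ} (G : Graph n) where

  -- p is a search tree on G[S]: a rooted tree with vertex set S such that, for every
  -- vertex v, the subtrees rooted at the children of v are the connected components
  -- of G[D(v)] - v, where D(v) is the vertex set of the subtree rooted at v
  -- (this unfolds the recursive definition); G[S] is connected.
  IsSearchTree : Subset n → Parent n → Set
  IsSearchTree S p =
    Connected G (_∈ S) ×
    (∀ v → v ∉ S → p v ≡ nothing) ×
    (∀ v w → p v ≡ just w → w ∈ S) ×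
    (∀ u → u ∈ S → Σ (Fin n) λ r → r ∈ S × p r ≡ nothing × (∀ w → w ∈ S → Anc p r w)) ×
    (∀ v c → p c ≡ just v →
       IsComponent G (λ u → Anc p v u × u ≢ v) (Anc p c))

  Rot : Subset n → Fin n → Fin n → Parent n → Parent n → Set
  Rot S a b p q =
    IsSearchTree S p ×
    p b ≡ just a ×
    q b ≡ p a ×
    q a ≡ just b ×
    (∀ c → p c ≡ just b →
       (Walk G (λ u → Anc p a u × u ≢ b) c a → q c ≡ just a) ×
       (¬ Walk G (λ u → Anc p a u × u ≢ b) c a → q c ≡ just b)) ×
    (∀ u → u ≢ a → u ≢ b → p u ≢ just b → q u ≡ p u)

  -- A sequence of rotations (pairs (a , b), b a child of a) transforming p into q,
  -- all intermediate trees being search trees on G[S].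
  data RotSeq (S : Subset n) : Parent n → List (Fin n × Fin n) → Parent n → Set where
    done : ∀ {p q} → IsSearchTree S p → (∀ v → p v ≡ q v) → RotSeq S p [] q
    step : ∀ {p p' q a b π} → Rot S a b p p' → RotSeq S p' π q →
           RotSeq S p ((a , b) ∷ π) q

module _ {n : ℕ} where

  _≟M_ : (x y : Maybe (Fin n)) → Dec (x ≡ y)
  _≟M_ = Data.Maybe.Properties.≡-dec _≟_
    where import Data.Maybe.Properties

  delete : Fin n → Parent n → Parent n
  delete v p u with u ≟ v
  ... | yes _ = nothing
  ... | no _ with p u ≟M just v
  ...   | yes _ = p v
  ...   | no _  = p u

  deleteAll : List (Fin n) → Parent n → Parent n
  deleteAll [] p = p
  deleteAll (v ∷ ℓ) p = deleteAll ℓ (delete v p)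

  restrict : Subset n → List (Fin n × Fin n) → List (Fin n × Fin n)
  restrict S = filter (λ ab → (Data.Product.proj₁ ab ∈? S) ×-dec (Data.Product.proj₂ ab ∈? S))

{-# OPTIONS --safe #-}
-- Deleting a simplicial vertex v from a search tree on G[R] gives a search tree on G[R] - v,
-- since walks through v can bypass it across the clique of its neighbours.  A rotation at
-- (a, b) with a, b ≠ v commutes with deleting v, while a rotation involving v becomes the
-- identity once v is deleted, because a simplicial vertex has at most one child.  So deleting
-- v maps a rotation sequence to its restriction, and iterating along the elimination order
-- proves the claim.  The result does not depend on the elimination order: the parent of u in
-- T_{|S} is the nearest proper ancestor of u in T that lies in S.
module Submission where

open import Defs hiding (sym)
open import Data.Nat using (ℕ)
open import Data.Fin using (Fin; zero; suc)
open import Data.Fin.Properties using (_≟_)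
open import Data.Fin.Subset using (Subset; ⊤; _∈_; _∉_; _─_; ⁅_⁆; _⊆_; inside; outside)
open import Data.Fin.Subset.Properties using (_∈?_; x∈⁅x⁆; x∈⁅y⁆⇒x≡y; x∈p∧x∉q⇒x∈p─q; p─q⊆p)
open import Data.Maybe using (Maybe; just; nothing)
open import Data.Maybe.Properties using (just-injective)
open import Data.Product using (Σ; _×_; _,_; proj₁; proj₂)
open import Data.List using (List; []; _∷_)
open import Data.List.Properties using (filter-accept; filter-reject; filter-all)
open import Data.List.Relation.Unary.All using (All; []; _∷_)
open import Data.Vec using (_∷_; here; there)
open import Data.Empty using (⊥-elim)
open import Function using (_∘_)
open import Relation.Nullary using (¬_; yes; no; Dec)
open import Relation.Nullary.Decidable using (_×-dec_)
open import Relation.Binary.PropositionalEquality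
  using (_≡_; _≢_; _≗_; refl; sym; trans; cong; subst; ≢-sym; module ≡-Reasoning)

private
  variable
    n : ℕ

x∈p─q⇒x∉q : ∀ {x : Fin n} (p q : Subset n) → x ∈ p ─ q → x ∉ q
x∈p─q⇒x∉q {x = zero}  (_ ∷ p)      (inside ∷ q)  ()
x∈p─q⇒x∉q {x = zero}  (inside ∷ p) (outside ∷ q) here      = λ ()
x∈p─q⇒x∉q {x = suc x} (_ ∷ p)      (_ ∷ q)       (there h) (there h') =
  x∈p─q⇒x∉q p q h h'

module _ {p : Subset n} {x y : Fin n} where

  x∈p─⁅y⁆⇒x≢y : x ∈ p ─ ⁅ y ⁆ → x ≢ y
  x∈p─⁅y⁆⇒x≢y h refl = x∈p─q⇒x∉q p ⁅ y ⁆ h (x∈⁅x⁆ y)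

  x∈p─⁅y⁆⇒x∈p : x ∈ p ─ ⁅ y ⁆ → x ∈ p
  x∈p─⁅y⁆⇒x∈p = p─q⊆p p ⁅ y ⁆

  x∈p∧x≢y⇒x∈p─⁅y⁆ : x ∈ p → x ≢ y → x ∈ p ─ ⁅ y ⁆
  x∈p∧x≢y⇒x∈p─⁅y⁆ h x≢y = x∈p∧x∉q⇒x∈p─q h (x≢y ∘ x∈⁅y⁆⇒x≡y y)

module _ {A : Set} {m : Maybe A} where

  ≡just⇒≢nothing : ∀ {w} → m ≡ just w → m ≢ nothing
  ≡just⇒≢nothing refl ()

  ≡just⇒≢just : ∀ {v w} → m ≡ just w → w ≢ v → m ≢ just v
  ≡just⇒≢just m≡w w≢v m≡v = w≢v (just-injective (trans (sym m≡w) m≡v))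

  ≡just∧≢just⇒≢ : ∀ {v w} → m ≡ just w → m ≢ just v → w ≢ v
  ≡just∧≢just⇒≢ m≡w m≢v refl = m≢v m≡w

module _ {v : Fin n} {p : Parent n} where

  delete-self : delete v p v ≡ nothing
  delete-self with v ≟ v
  ... | yes _  = refl
  ... | no v≢v = ⊥-elim (v≢v refl)

  delete-child : ∀ {u} → u ≢ v → p u ≡ just v → delete v p u ≡ p v
  delete-child {u} u≢v pu≡v with u ≟ v
  ... | yes u≡v = ⊥-elim (u≢v u≡v)
  ... | no _ with p u ≟M just v
  ...   | yes _   = refl
  ...   | no pu≢v = ⊥-elim (pu≢v pu≡v)

  delete-other : ∀ {u} → u ≢ v → p u ≢ just v → delete v p u ≡ p u
  delete-other {u} u≢v pu≢v with u ≟ v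
  ... | yes u≡v = ⊥-elim (u≢v u≡v)
  ... | no _ with p u ≟M just v
  ...   | yes pu≡v = ⊥-elim (pu≢v pu≡v)
  ...   | no _     = refl

  delete-just : ∀ {u w} → u ≢ v → p u ≡ just w → w ≢ v → delete v p u ≡ just w
  delete-just u≢v pu≡w w≢v =
    trans (delete-other u≢v (≡just⇒≢just pu≡w w≢v)) pu≡w

  data DeleteView (u : Fin n) : Set where
    removed : u ≡ v → delete v p u ≡ nothing → DeleteView u
    lifted  : u ≢ v → p u ≡ just v → delete v p u ≡ p v → DeleteView u
    kept    : u ≢ v → p u ≢ just v → delete v p u ≡ p u → DeleteView u

  deleteView : ∀ u → DeleteView u
  deleteView u with u ≟ v | p u ≟M just v
  ... | yes refl | _        = removed refl delete-self
  ... | no u≢v   | yes pu≡v = lifted u≢v pu≡v (delete-child u≢v pu≡v)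
  ... | no u≢v   | no pu≢v  = kept u≢v pu≢v (delete-other u≢v pu≢v)

delete-agree : ∀ {v u} {p q : Parent n} → u ≢ v → p u ≢ just v → p u ≡ q u →
               delete v p u ≡ delete v q u
delete-agree u≢v pu≢v pu≡qu =
  trans (delete-other u≢v pu≢v) (trans pu≡qu (sym (delete-other u≢v (pu≢v ∘ trans pu≡qu))))

delete-cong : ∀ (v : Fin n) {p q : Parent n} → p ≗ q → delete v p ≗ delete v q
delete-cong v {p} {q} p≗q u with deleteView {v = v} {p} u
... | removed refl d = trans d (sym (delete-self {v = v} {q}))
... | lifted u≢v pu≡v d =
  trans d (trans (p≗q v) (sym (delete-child u≢v (trans (sym (p≗q u)) pu≡v))))
... | kept u≢v pu≢v _ = delete-agree u≢v pu≢v (p≗q u)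

module _ {p : Parent n} where

  Anc-trans : ∀ {x y z} → Anc p x y → Anc p y z → Anc p x z
  Anc-trans x≤y self          = x≤y
  Anc-trans x≤y (up pz≡w y≤w) = up pz≡w (Anc-trans x≤y y≤w)

  Anc-root : ∀ {x y} → Anc p x y → p y ≡ nothing → x ≡ y
  Anc-root self           _ = refl
  Anc-root (up py≡w _) py≡∅ = ⊥-elim (≡just⇒≢nothing py≡w py≡∅)

  Anc-child : ∀ {v u} → Anc p v u → u ≢ v → Σ (Fin n) λ c → p c ≡ just v × Anc p c u
  Anc-child self u≢v = ⊥-elim (u≢v refl)
  Anc-child {v} (up {u} {w} pu≡w v≤w) u≢v with w ≟ v
  ... | yes refl = u , pu≡w , self
  ... | no w≢v with Anc-child v≤w w≢v
  ...   | c , pc≡v , c≤w = c , pc≡v , up pu≡w c≤w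

Anc-resp : ∀ {p q : Parent n} → p ≗ q → ∀ {x y} → Anc p x y → Anc q x y
Anc-resp p≗q self          = self
Anc-resp p≗q (up {y} py≡w r) = up (trans (sym (p≗q y)) py≡w) (Anc-resp p≗q r)

Anc-delete⁻ : ∀ {p : Parent n} {v x y} → x ≢ v → Anc (delete v p) x y → Anc p x y × y ≢ v
Anc-delete⁻ x≢v self = self , x≢v
Anc-delete⁻ {p = p} {v} x≢v (up {y} e r) with deleteView {v = v} {p} y
... | removed _ d       = ⊥-elim (≡just⇒≢nothing e d)
... | lifted y≢v py≡v d = up py≡v (up (trans (sym d) e) (proj₁ (Anc-delete⁻ x≢v r))) , y≢v
... | kept y≢v _ d      = up (trans (sym d) e) (proj₁ (Anc-delete⁻ x≢v r)) , y≢v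

module _ (G : Graph n) where

  Walk-start : ∀ {X x y} → Walk G X x y → X x
  Walk-start (here h)     = h
  Walk-start (step h _ _) = h

  Walk-map : ∀ {X Y : Fin n → Set} {x y} → (∀ u → X u → Y u) → Walk G X x y → Walk G Y x y
  Walk-map f (here h)     = here (f _ h)
  Walk-map f (step h e r) = step (f _ h) e (Walk-map f r)

  Walk-++ : ∀ {X x y z} → Walk G X x y → Walk G X y z → Walk G X x z
  Walk-++ (here _)     w = w
  Walk-++ (step h e r) w = step h e (Walk-++ r w)

  Walk-reverse : ∀ {X x y} → Walk G X x y → Walk G X y x
  Walk-reverse (here h)     = here h
  Walk-reverse (step h e r) =
    Walk-++ (Walk-reverse r) (step (Walk-start r) (Graph.sym G e) (here h))

  Walk-closed : ∀ {X Y C : Fin n → Set} {x y} → (∀ u w → C u → X w → Adj G u w → C w) →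
                (∀ u → Y u → X u) → Walk G Y x y → C x → C y
  Walk-closed cl Y⊆X (here _)             Cx = Cx
  Walk-closed cl Y⊆X (step {u} {w} _ e r) Cu =
    Walk-closed cl Y⊆X r (cl u w Cu (Y⊆X w (Walk-start r)) e)

  Walk-exit : ∀ {X Y C : Fin n → Set} {x t} → (∀ u w → C u → X w → Adj G u w → C w) →
              (∀ u → Y u → u ≢ t → X u) → ¬ C t → Walk G Y x t → C x →
              Σ (Fin n) λ u → C u × Adj G u t
  Walk-exit cl Y⊆X ¬Ct (here _) Ct = ⊥-elim (¬Ct Ct)
  Walk-exit {t = t} cl Y⊆X ¬Ct (step {u} {w} _ e r) Cu with w ≟ t
  ... | yes refl = u , Cu , e
  ... | no w≢t   = Walk-exit cl Y⊆X ¬Ct r (cl u w Cu (Y⊆X w (Walk-start r) w≢t) e)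

  -- The neighbours of v before and after it on the walk are adjacent, so v can be cut out.
  Walk-avoid-simplicial : ∀ {X : Fin n → Set} {R : Subset n} {v x y} → Simplicial G R v →
                          (∀ u → X u → u ∈ R) → Walk G X x y → x ≢ v → y ≢ v →
                          Walk G (λ u → X u × u ≢ v) x y
  Walk-avoid-simplicial simp X⊆R (here h) x≢v y≢v = here (h , x≢v)
  Walk-avoid-simplicial {v = v} simp X⊆R (step {u} {w} h e r) u≢v y≢v with w ≟ v
  ... | no w≢v = step (h , u≢v) e (Walk-avoid-simplicial simp X⊆R r w≢v y≢v)
  ... | yes refl with r
  ...   | here _ = ⊥-elim (y≢v refl)
  ...   | step {_} {w'} h' e' r' with u ≟ w'
  ...     | yes refl = Walk-avoid-simplicial simp X⊆R r' u≢v y≢v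
  ...     | no u≢w' =
    step (h , u≢v) (simp u w' (X⊆R u h) (X⊆R w' (Walk-start r')) u≢w' (Graph.sym G e) e')
         (Walk-avoid-simplicial simp X⊆R r' (λ { refl → Graph.irrefl G e' }) y≢v)

module SearchTree {G : Graph n} {R : Subset n} {p : Parent n} (st : IsSearchTree G R p) where

  connected : Connected G (_∈ R)
  connected = proj₁ st

  outside-orphan : ∀ v → v ∉ R → p v ≡ nothing
  outside-orphan = proj₁ (proj₂ st)

  parent-∈ : ∀ v w → p v ≡ just w → w ∈ R
  parent-∈ = proj₁ (proj₂ (proj₂ st))

  root : ∀ u → u ∈ R → Σ (Fin n) λ r → r ∈ R × p r ≡ nothing × (∀ w → w ∈ R → Anc p r w)
  root = proj₁ (proj₂ (proj₂ (proj₂ st)))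

  child-component : ∀ v c → p c ≡ just v → IsComponent G (λ u → Anc p v u × u ≢ v) (Anc p c)
  child-component = proj₂ (proj₂ (proj₂ (proj₂ st)))

  module _ {c v : Fin n} (pc≡v : p c ≡ just v) where

    child-⊆ : ∀ {u} → Anc p c u → Anc p v u × u ≢ v
    child-⊆ = proj₁ (child-component v c pc≡v) _

    child-connected : Connected G (Anc p c)
    child-connected = proj₁ (proj₂ (proj₂ (child-component v c pc≡v)))

    child-closed : ∀ u w → Anc p c u → Anc p v w × w ≢ v → Adj G u w → Anc p c w
    child-closed = proj₂ (proj₂ (proj₂ (child-component v c pc≡v)))

    parent-∉-child : ¬ Anc p c v
    parent-∉-child c≤v = proj₂ (child-⊆ c≤v) refl

  child-∈ : ∀ {v w} → p v ≡ just w → v ∈ R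
  child-∈ {v} pv≡w with v ∈? R
  ... | yes v∈R = v∈R
  ... | no  v∉R = ⊥-elim (≡just⇒≢nothing pv≡w (outside-orphan v v∉R))

  Anc-∈ : ∀ {x y} → Anc p x y → x ∈ R → y ∈ R
  Anc-∈ self       x∈R = x∈R
  Anc-∈ (up pv≡w _) _  = child-∈ pv≡w

  parent-≢ : ∀ {x w} → p x ≡ just w → w ≢ x
  parent-≢ px≡x refl = parent-∉-child px≡x self

  subtree-connected : ∀ {x} → x ∈ R → Connected G (Anc p x)
  subtree-connected {x} x∈R with p x in px
  ... | just y = child-connected px
  ... | nothing with root x x∈R
  ...   | r , _ , _ , r≤ with Anc-root (r≤ x x∈R) px
  ...     | refl = λ u w x≤u x≤w →
    Walk-map G r≤ (connected u w (Anc-∈ x≤u x∈R) (Anc-∈ x≤w x∈R))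

  subtree-adjacent-parent : ∀ {c v} → p c ≡ just v → Σ (Fin n) λ u → Anc p c u × Adj G u v
  subtree-adjacent-parent {c} {v} pc≡v =
    Walk-exit G (child-closed pc≡v) (λ u v≤u u≢v → v≤u , u≢v) (parent-∉-child pc≡v)
      (subtree-connected (parent-∈ c v pc≡v) c v (up pc≡v self) self) self

  sibling-∉ : ∀ {c₁ c₂ v} → p c₁ ≡ just v → p c₂ ≡ just v → c₁ ≢ c₂ → ¬ Anc p c₁ c₂
  sibling-∉ _    _    c₁≢c₂ self = c₁≢c₂ refl
  sibling-∉ pc₁≡v pc₂≡v c₁≢c₂ (up pc₂≡w c₁≤w)
    with just-injective (trans (sym pc₂≡w) pc₂≡v)
  ... | refl = parent-∉-child pc₁≡v c₁≤w

  -- Both subtrees contain a neighbour of v; these are adjacent as v is simplicial,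
  -- so the subtrees, being components, coincide.
  simplicial-unique-child : ∀ {v c₁ c₂} → Simplicial G R v →
                            p c₁ ≡ just v → p c₂ ≡ just v → c₁ ≡ c₂
  simplicial-unique-child {v} {c₁} {c₂} simp pc₁≡v pc₂≡v with c₁ ≟ c₂
  ... | yes c₁≡c₂ = c₁≡c₂
  ... | no c₁≢c₂  = ⊥-elim (sibling-∉ pc₁≡v pc₂≡v c₁≢c₂ c₂∈D₁)
    where
    common : Σ (Fin n) λ u → Anc p c₁ u × Anc p c₂ u
    common with subtree-adjacent-parent pc₁≡v | subtree-adjacent-parent pc₂≡v
    ... | u₁ , c₁≤u₁ , u₁~v | u₂ , c₂≤u₂ , u₂~v with u₁ ≟ u₂
    ...   | yes refl = u₁ , c₁≤u₁ , c₂≤u₂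
    ...   | no u₁≢u₂ = u₂ , child-closed pc₁≡v u₁ u₂ c₁≤u₁ (child-⊆ pc₂≡v c₂≤u₂) u₁~u₂ , c₂≤u₂
      where
      u₁~u₂ : Adj G u₁ u₂
      u₁~u₂ = simp u₁ u₂ (Anc-∈ c₁≤u₁ (child-∈ pc₁≡v)) (Anc-∈ c₂≤u₂ (child-∈ pc₂≡v))
                   u₁≢u₂ (Graph.sym G u₁~v) (Graph.sym G u₂~v)
    c₂∈D₁ : Anc p c₁ c₂
    c₂∈D₁ with common
    ... | u , c₁≤u , c₂≤u = Walk-closed G (child-closed pc₁≡v) (λ _ → child-⊆ pc₂≡v)
                              (Walk-reverse G (child-connected pc₂≡v c₂ u self c₂≤u)) c₁≤u

module DeleteSimplicial {G : Graph n} {R : Subset n} {p : Parent n} (st : IsSearchTree G R p)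
                        {v : Fin n} (simp : Simplicial G R v) where
  open SearchTree st

  p⁻ : Parent n
  p⁻ = delete v p

  R⁻ : Subset n
  R⁻ = R ─ ⁅ v ⁆

  Anc-delete⁺ : ∀ {x y} → x ≢ v → y ≢ v → Anc p x y → Anc p⁻ x y
  Anc-delete⁺ x≢v y≢v self = self
  Anc-delete⁺ x≢v y≢v (up {y} {w} py≡w w≤) with w ≟ v
  ... | no w≢v = up (delete-just y≢v py≡w w≢v) (Anc-delete⁺ x≢v w≢v w≤)
  ... | yes refl with w≤
  ...   | self = ⊥-elim (x≢v refl)
  ...   | up {_} {w'} pv≡w' w'≤ =
    up (trans (delete-child y≢v py≡w) pv≡w')
       (Anc-delete⁺ x≢v (parent-≢ pv≡w') w'≤)

  connected⁻ : Connected G (_∈ R⁻)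
  connected⁻ u w u∈ w∈ =
    Walk-map G (λ z (z∈R , z≢v) → x∈p∧x≢y⇒x∈p─⁅y⁆ z∈R z≢v)
      (Walk-avoid-simplicial G simp (λ _ z∈R → z∈R)
        (connected u w (x∈p─⁅y⁆⇒x∈p u∈) (x∈p─⁅y⁆⇒x∈p w∈))
        (x∈p─⁅y⁆⇒x≢y u∈) (x∈p─⁅y⁆⇒x≢y w∈))

  outside-orphan⁻ : ∀ u → u ∉ R⁻ → p⁻ u ≡ nothing
  outside-orphan⁻ u u∉ with deleteView {v = v} {p} u
  ... | removed _ d       = d
  ... | lifted u≢v pu≡v _ = ⊥-elim (u∉ (x∈p∧x≢y⇒x∈p─⁅y⁆ (child-∈ pu≡v) u≢v))
  ... | kept u≢v _ d with u ∈? R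
  ...   | yes u∈R = ⊥-elim (u∉ (x∈p∧x≢y⇒x∈p─⁅y⁆ u∈R u≢v))
  ...   | no u∉R  = trans d (outside-orphan u u∉R)

  parent-∈⁻ : ∀ u w → p⁻ u ≡ just w → w ∈ R⁻
  parent-∈⁻ u w e with deleteView {v = v} {p} u
  ... | removed _ d = ⊥-elim (≡just⇒≢nothing e d)
  ... | lifted _ _ d =
    let pv≡w = trans (sym d) e in
    x∈p∧x≢y⇒x∈p─⁅y⁆ (parent-∈ v w pv≡w) (parent-≢ pv≡w)
  ... | kept _ pu≢v d =
    let pu≡w = trans (sym d) e in
    x∈p∧x≢y⇒x∈p─⁅y⁆ (parent-∈ u w pu≡w) (≡just∧≢just⇒≢ pu≡w pu≢v)

  -- If v was the root, the child of v above u becomes the root: G[R⁻] is connected, so the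
  -- component of G[R] - v containing it is all of R⁻.
  root⁻ : ∀ u → u ∈ R⁻ →
          Σ (Fin n) λ r → r ∈ R⁻ × p⁻ r ≡ nothing × (∀ w → w ∈ R⁻ → Anc p⁻ r w)
  root⁻ u u∈ with root u (x∈p─⁅y⁆⇒x∈p u∈)
  ... | r , r∈R , pr≡∅ , r≤ with r ≟ v
  ...   | no r≢v = r , x∈p∧x≢y⇒x∈p─⁅y⁆ r∈R r≢v ,
                   trans (delete-other r≢v (λ pr≡v → ≡just⇒≢nothing pr≡v pr≡∅)) pr≡∅ ,
                   λ w w∈ → Anc-delete⁺ r≢v (x∈p─⁅y⁆⇒x≢y w∈) (r≤ w (x∈p─⁅y⁆⇒x∈p w∈))
  ...   | yes refl with Anc-child (r≤ u (x∈p─⁅y⁆⇒x∈p u∈)) (x∈p─⁅y⁆⇒x≢y u∈)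
  ...     | c , pc≡v , _ = c , c∈ , trans (delete-child c≢v pc≡v) pr≡∅ ,
              λ w w∈ → Anc-delete⁺ c≢v (x∈p─⁅y⁆⇒x≢y w∈)
                (Walk-closed G (child-closed pc≡v)
                   (λ z z∈ → r≤ z (x∈p─⁅y⁆⇒x∈p z∈) , x∈p─⁅y⁆⇒x≢y z∈)
                   (connected⁻ c w c∈ w∈) self)
    where
    c≢v : c ≢ v
    c≢v = ≢-sym (parent-≢ pc≡v)
    c∈ : c ∈ R⁻
    c∈ = x∈p∧x≢y⇒x∈p─⁅y⁆ (child-∈ pc≡v) c≢v

  private
    Below⁻ : Fin n → Fin n → Set
    Below⁻ v' u = Anc p⁻ v' u × u ≢ v'

  component⁻-kept : ∀ {c v'} → c ≢ v → p c ≡ just v' → v' ≢ v →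
                    IsComponent G (Below⁻ v') (Anc p⁻ c)
  component⁻-kept {c} {v'} c≢v pc≡v' v'≢v = ⊆below , (c , self) , connected-c , closed-c
    where
    ⊆below : ∀ u → Anc p⁻ c u → Below⁻ v' u
    ⊆below u c≤u with Anc-delete⁻ c≢v c≤u
    ... | c≤u' , u≢v with child-⊆ pc≡v' c≤u'
    ...   | v'≤u , u≢v' = Anc-delete⁺ v'≢v u≢v v'≤u , u≢v'
    connected-c : Connected G (Anc p⁻ c)
    connected-c u w c≤u c≤w with Anc-delete⁻ c≢v c≤u | Anc-delete⁻ c≢v c≤w
    ... | c≤u' , u≢v | c≤w' , w≢v =
      Walk-map G (λ z (c≤z , z≢v) → Anc-delete⁺ c≢v z≢v c≤z)
        (Walk-avoid-simplicial G simp (λ z c≤z → Anc-∈ c≤z (child-∈ pc≡v'))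
           (child-connected pc≡v' u w c≤u' c≤w') u≢v w≢v)
    closed-c : ∀ u w → Anc p⁻ c u → Below⁻ v' w → Adj G u w → Anc p⁻ c w
    closed-c u w c≤u (v'≤w , w≢v') u~w with Anc-delete⁻ c≢v c≤u | Anc-delete⁻ v'≢v v'≤w
    ... | c≤u' , _ | v'≤w' , w≢v =
      Anc-delete⁺ c≢v w≢v (child-closed pc≡v' u w c≤u' (v'≤w' , w≢v') u~w)

  component⁻-lifted : ∀ {c v'} → c ≢ v → p c ≡ just v → p v ≡ just v' →
                      IsComponent G (Below⁻ v') (Anc p⁻ c)
  component⁻-lifted {c} {v'} c≢v pc≡v pv≡v' = ⊆below , (c , self) , connected-c , closed-c
    where
    v'≢v : v' ≢ v
    v'≢v = parent-≢ pv≡v'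
    ⊆below : ∀ u → Anc p⁻ c u → Below⁻ v' u
    ⊆below u c≤u with Anc-delete⁻ c≢v c≤u
    ... | c≤u' , u≢v with child-⊆ pv≡v' (proj₁ (child-⊆ pc≡v c≤u'))
    ...   | v'≤u , u≢v' = Anc-delete⁺ v'≢v u≢v v'≤u , u≢v'
    connected-c : Connected G (Anc p⁻ c)
    connected-c u w c≤u c≤w with Anc-delete⁻ c≢v c≤u | Anc-delete⁻ c≢v c≤w
    ... | c≤u' , _ | c≤w' , _ =
      Walk-map G (λ z c≤z → Anc-delete⁺ c≢v (proj₂ (child-⊆ pc≡v c≤z)) c≤z)
        (child-connected pc≡v u w c≤u' c≤w')
    closed-c : ∀ u w → Anc p⁻ c u → Below⁻ v' w → Adj G u w → Anc p⁻ c w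
    closed-c u w c≤u (v'≤w , w≢v') u~w with Anc-delete⁻ c≢v c≤u | Anc-delete⁻ v'≢v v'≤w
    ... | c≤u' , _ | v'≤w' , w≢v =
      Anc-delete⁺ c≢v w≢v (child-closed pc≡v u w c≤u' (v≤w , w≢v) u~w)
      where
      v≤w : Anc p v w
      v≤w = child-closed pv≡v' u w (proj₁ (child-⊆ pc≡v c≤u')) (v'≤w' , w≢v') u~w

  child-component⁻ : ∀ v' c → p⁻ c ≡ just v' → IsComponent G (Below⁻ v') (Anc p⁻ c)
  child-component⁻ v' c e with deleteView {v = v} {p} c
  ... | removed _ d       = ⊥-elim (≡just⇒≢nothing e d)
  ... | lifted c≢v pc≡v d = component⁻-lifted c≢v pc≡v (trans (sym d) e)
  ... | kept c≢v pc≢v d   =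
    let pc≡v' = trans (sym d) e in
    component⁻-kept c≢v pc≡v' (≡just∧≢just⇒≢ pc≡v' pc≢v)

  isSearchTree⁻ : IsSearchTree G R⁻ p⁻
  isSearchTree⁻ = connected⁻ , outside-orphan⁻ , parent-∈⁻ , root⁻ , child-component⁻

IsSearchTree-delete : ∀ {G : Graph n} {R p v} → IsSearchTree G R p → Simplicial G R v →
                      IsSearchTree G (R ─ ⁅ v ⁆) (delete v p)
IsSearchTree-delete st simp = DeleteSimplicial.isSearchTree⁻ st simp

module Rotation {G : Graph n} {R : Subset n} {a b : Fin n} {p q : Parent n}
                (rot : Rot G R a b p q) where

  isSearchTree : IsSearchTree G R p
  isSearchTree = proj₁ rot

  open SearchTree isSearchTree public

  A∖b : Fin n → Set
  A∖b u = Anc p a u × u ≢ b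

  pb≡a : p b ≡ just a
  pb≡a = proj₁ (proj₂ rot)

  qb≡pa : q b ≡ p a
  qb≡pa = proj₁ (proj₂ (proj₂ rot))

  qa≡b : q a ≡ just b
  qa≡b = proj₁ (proj₂ (proj₂ (proj₂ rot)))

  reattached-a : ∀ c → p c ≡ just b → Walk G A∖b c a → q c ≡ just a
  reattached-a c pc≡b = proj₁ (proj₁ (proj₂ (proj₂ (proj₂ (proj₂ rot)))) c pc≡b)

  reattached-b : ∀ c → p c ≡ just b → ¬ Walk G A∖b c a → q c ≡ just b
  reattached-b c pc≡b = proj₂ (proj₁ (proj₂ (proj₂ (proj₂ (proj₂ rot)))) c pc≡b)

  unchanged : ∀ u → u ≢ a → u ≢ b → p u ≢ just b → q u ≡ p u
  unchanged = proj₂ (proj₂ (proj₂ (proj₂ (proj₂ rot))))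

  unchanged-just : ∀ {u w} → u ≢ a → u ≢ b → p u ≡ just w → w ≢ b → q u ≡ just w
  unchanged-just u≢a u≢b pu≡w w≢b = trans (unchanged _ u≢a u≢b (≡just⇒≢just pu≡w w≢b)) pu≡w

  a∈R : a ∈ R
  a∈R = parent-∈ b a pb≡a

  b∈R : b ∈ R
  b∈R = child-∈ pb≡a

  b≢a : b ≢ a
  b≢a = ≢-sym (parent-≢ pb≡a)

  a∈A∖b : A∖b a
  a∈A∖b = self , ≢-sym b≢a

  grandchild-⊆ : ∀ {c u} → p c ≡ just b → Anc p c u → A∖b u
  grandchild-⊆ pc≡b c≤u with child-⊆ pc≡b c≤u
  ... | b≤u , u≢b = Anc-trans (up pb≡a self) b≤u , u≢b

  grandchild-walk : ∀ {c x} → p c ≡ just b → Anc p c x → Walk G A∖b c x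
  grandchild-walk pc≡b c≤x =
    Walk-map G (λ _ → grandchild-⊆ pc≡b) (child-connected pc≡b _ _ self c≤x)

  A∖b⊆R : ∀ u → A∖b u → u ∈ R
  A∖b⊆R u (a≤u , _) = Anc-∈ a≤u a∈R

module RotationDelete {G : Graph n} {R : Subset n} {a b : Fin n} {p q : Parent n}
                      (rot : Rot G R a b p q) {v : Fin n} (simp : Simplicial G R v)
                      (a≢v : a ≢ v) (b≢v : b ≢ v) where
  open Rotation rot
  open DeleteSimplicial isSearchTree simp using (p⁻; Anc-delete⁺)

  q⁻ : Parent n
  q⁻ = delete v q

  p⁻b≡a : p⁻ b ≡ just a
  p⁻b≡a = delete-just b≢v pb≡a a≢v

  q⁻b≡p⁻a : q⁻ b ≡ p⁻ a
  q⁻b≡p⁻a with deleteView {v = v} {p} a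
  ... | removed a≡v _ = ⊥-elim (a≢v a≡v)
  ... | lifted _ pa≡v d = begin
    q⁻ b ≡⟨ delete-child b≢v (trans qb≡pa pa≡v) ⟩
    q v  ≡⟨ unchanged v (≢-sym a≢v) (≢-sym b≢v) pv≢b ⟩
    p v  ≡⟨ d ⟨
    p⁻ a ∎
    where
    open ≡-Reasoning
    pv≢b : p v ≢ just b
    pv≢b pv≡b = parent-∉-child pv≡b (up pb≡a (up pa≡v self))
  ... | kept _ pa≢v d = begin
    q⁻ b ≡⟨ delete-other b≢v (pa≢v ∘ trans (sym qb≡pa)) ⟩
    q b  ≡⟨ qb≡pa ⟩
    p a  ≡⟨ d ⟨
    p⁻ a ∎
    where open ≡-Reasoning

  q⁻a≡b : q⁻ a ≡ just b
  q⁻a≡b = delete-just a≢v qa≡b b≢v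

  A∖b⁻ : Fin n → Set
  A∖b⁻ u = Anc p⁻ a u × u ≢ b

  Walk-A∖b⁻⇒A∖b : ∀ {c} → Walk G A∖b⁻ c a → Walk G A∖b c a
  Walk-A∖b⁻⇒A∖b = Walk-map G (λ u (a≤u , u≢b) → proj₁ (Anc-delete⁻ a≢v a≤u) , u≢b)

  Walk-A∖b⇒A∖b⁻ : ∀ {c} → c ≢ v → Walk G A∖b c a → Walk G A∖b⁻ c a
  Walk-A∖b⇒A∖b⁻ c≢v w =
    Walk-map G (λ u ((a≤u , u≢b) , u≢v) → Anc-delete⁺ a≢v u≢v a≤u , u≢b)
      (Walk-avoid-simplicial G simp A∖b⊆R w c≢v a≢v)

  -- A child c of the deleted v in p is a child of b in p⁻ and is reattached exactly as v is.
  reattached⁻ : ∀ c → p⁻ c ≡ just b →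
                (Walk G A∖b⁻ c a → q⁻ c ≡ just a) × (¬ Walk G A∖b⁻ c a → q⁻ c ≡ just b)
  reattached⁻ c e with deleteView {v = v} {p} c
  ... | removed _ d = ⊥-elim (≡just⇒≢nothing e d)
  ... | kept c≢v _ d =
    let pc≡b = trans (sym d) e in
    (λ w → delete-just c≢v (reattached-a c pc≡b (Walk-A∖b⁻⇒A∖b w)) a≢v) ,
    (λ ¬w → delete-just c≢v (reattached-b c pc≡b (¬w ∘ Walk-A∖b⇒A∖b⁻ c≢v)) b≢v)
  ... | lifted c≢v pc≡v d =
    (λ w → trans q⁻c≡qv (reattached-a v pv≡b (Walk-++ G v~c (Walk-A∖b⁻⇒A∖b w)))) ,
    (λ ¬w → trans q⁻c≡qv
              (reattached-b v pv≡b (¬w ∘ Walk-A∖b⇒A∖b⁻ c≢v ∘ Walk-++ G (Walk-reverse G v~c))))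
    where
    pv≡b : p v ≡ just b
    pv≡b = trans (sym d) e
    c≢a : c ≢ a
    c≢a refl = parent-∉-child pc≡v (up pv≡b (up pb≡a self))
    c≢b : c ≢ b
    c≢b refl = a≢v (just-injective (trans (sym pb≡a) pc≡v))
    q⁻c≡qv : q⁻ c ≡ q v
    q⁻c≡qv = delete-child c≢v (unchanged-just c≢a c≢b pc≡v (≢-sym b≢v))
    v~c : Walk G A∖b v c
    v~c = grandchild-walk pv≡b (up pc≡v self)

  unchanged⁻ : ∀ u → u ≢ a → u ≢ b → p⁻ u ≢ just b → q⁻ u ≡ p⁻ u
  unchanged⁻ u u≢a u≢b p⁻u≢b with deleteView {v = v} {p} u
  ... | removed refl d = trans (delete-self {v = v} {q}) (sym d)
  ... | lifted u≢v pu≡v d = begin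
    q⁻ u ≡⟨ delete-child u≢v (unchanged-just u≢a u≢b pu≡v (≢-sym b≢v)) ⟩
    q v  ≡⟨ unchanged v (≢-sym a≢v) (≢-sym b≢v) (p⁻u≢b ∘ trans d) ⟩
    p v  ≡⟨ d ⟨
    p⁻ u ∎
    where open ≡-Reasoning
  ... | kept u≢v pu≢v d =
    sym (delete-agree u≢v pu≢v (sym (unchanged u u≢a u≢b (p⁻u≢b ∘ trans d))))

  rot⁻ : Rot G (R ─ ⁅ v ⁆) a b p⁻ q⁻
  rot⁻ = IsSearchTree-delete isSearchTree simp ,
         p⁻b≡a , q⁻b≡p⁻a , q⁻a≡b , reattached⁻ , unchanged⁻

module RotationSimplicial {G : Graph n} {R : Subset n} {a b : Fin n} {p q : Parent n}
                          (rot : Rot G R a b p q) where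
  open Rotation rot

  -- Some vertex y below b is adjacent to a.  If y = b, simpliciality of b makes a adjacent
  -- to the neighbour of b found below c; otherwise y lies below the unique child c of b.
  child-of-simplicial-b-reaches-a : Simplicial G R b → ∀ {c} → p c ≡ just b → Walk G A∖b c a
  child-of-simplicial-b-reaches-a simp {c} pc≡b with subtree-adjacent-parent pb≡a
  ... | y , b≤y , y~a with y ≟ b
  ...   | yes refl with subtree-adjacent-parent pc≡b
  ...     | x , c≤x , x~b =
    Walk-++ G (grandchild-walk pc≡b c≤x)
      (step (grandchild-⊆ pc≡b c≤x)
            (simp x a (Anc-∈ c≤x (child-∈ pc≡b)) a∈R x≢a (Graph.sym G x~b) y~a) (here a∈A∖b))
    where
    x≢a : x ≢ a
    x≢a refl = parent-∉-child pb≡a (proj₁ (child-⊆ pc≡b c≤x))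
  child-of-simplicial-b-reaches-a simp {c} pc≡b | y , b≤y , y~a | no y≢b with Anc-child b≤y y≢b
  ...   | c' , pc'≡b , c'≤y with simplicial-unique-child simp pc≡b pc'≡b
  ...     | refl =
    Walk-++ G (grandchild-walk pc≡b c'≤y) (step (grandchild-⊆ pc≡b c'≤y) y~a (here a∈A∖b))

  delete-lower : Simplicial G R b → delete b p ≗ delete b q
  delete-lower simp u with deleteView {v = b} {p} u
  ... | removed refl d = trans d (sym (delete-self {v = b} {q}))
  ... | lifted u≢b pu≡b d = trans d (trans pb≡a (sym q⁻u≡a))
    where
    q⁻u≡a : delete b q u ≡ just a
    q⁻u≡a = delete-just u≢b (reattached-a u pu≡b (child-of-simplicial-b-reaches-a simp pu≡b))
                        (≢-sym b≢a)
  ... | kept u≢b pu≢b d with u ≟ a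
  ...   | yes refl = trans d (sym (trans (delete-child u≢b qa≡b) qb≡pa))
  ...   | no u≢a   = delete-agree u≢b pu≢b (sym (unchanged u u≢a u≢b pu≢b))

  -- As a is simplicial, b is its only child; deleting a then hangs b below p a = q b in both
  -- trees, and the children of b that the rotation moves to a return to b.
  delete-upper : Simplicial G R a → delete a p ≗ delete a q
  delete-upper simp u with deleteView {v = a} {p} u
  ... | removed refl d = trans d (sym (delete-self {v = a} {q}))
  ... | lifted u≢a pu≡a d with u ≟ b
  ...   | yes refl = trans d (sym (trans (delete-other u≢a qb≢a) qb≡pa))
    where
    qb≢a : q b ≢ just a
    qb≢a qb≡a = parent-≢ (trans (sym qb≡pa) qb≡a) refl
  ...   | no u≢b   = ⊥-elim (u≢b (simplicial-unique-child simp pu≡a pb≡a))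
  delete-upper simp u | kept u≢a pu≢a d with u ≟ b
  ...   | yes refl = ⊥-elim (pu≢a pb≡a)
  ...   | no u≢b with p u ≟M just b
  ...     | no pu≢b = delete-agree u≢a pu≢a (sym (unchanged u u≢a u≢b pu≢b))
  ...     | yes pu≡b with q u ≟M just a
  ...       | yes qu≡a = trans d (trans pu≡b (sym (trans (delete-child u≢a qu≡a) qa≡b)))
  ...       | no qu≢a  = trans d (trans pu≡b (sym (delete-just u≢a
                           (reattached-b u pu≡b (qu≢a ∘ reattached-a u pu≡b)) b≢a)))

module _ {G : Graph n} where

  IsComponent-resp : ∀ {X X' C C' : Fin n → Set} →
                     (∀ u → X u → X' u) → (∀ u → X' u → X u) →
                     (∀ u → C u → C' u) → (∀ u → C' u → C u) →
                     IsComponent G X C → IsComponent G X' C'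
  IsComponent-resp X⊆X' X'⊆X C⊆C' C'⊆C (C⊆X , (u , Cu) , connected-C , closed-C) =
    (λ u → X⊆X' u ∘ C⊆X u ∘ C'⊆C u) , (u , C⊆C' u Cu) ,
    (λ u w C'u C'w → Walk-map G C⊆C' (connected-C u w (C'⊆C u C'u) (C'⊆C w C'w))) ,
    (λ u w C'u X'w u~w → C⊆C' w (closed-C u w (C'⊆C u C'u) (X'⊆X w X'w) u~w))

  IsSearchTree-resp : ∀ {R} {p q : Parent n} → p ≗ q → IsSearchTree G R p → IsSearchTree G R q
  IsSearchTree-resp {p = p} {q} p≗q (connected , orphan , parent-∈ , root , component) =
    connected ,
    (λ v v∉R → trans (sym (p≗q v)) (orphan v v∉R)) ,
    (λ v w qv≡w → parent-∈ v w (trans (p≗q v) qv≡w)) ,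
    (λ u u∈R → let (r , r∈R , pr≡∅ , r≤) = root u u∈R in
               r , r∈R , trans (sym (p≗q r)) pr≡∅ , λ w w∈R → Anc-resp p≗q (r≤ w w∈R)) ,
    (λ v c qc≡v → IsComponent-resp (λ u (v≤u , u≢v) → Anc-resp p≗q v≤u , u≢v)
                                   (λ u (v≤u , u≢v) → Anc-resp q≗p v≤u , u≢v)
                                   (λ u → Anc-resp p≗q) (λ u → Anc-resp q≗p)
                                   (component v c (trans (p≗q c) qc≡v)))
    where
    q≗p : q ≗ p
    q≗p = sym ∘ p≗q

  Rot-respˡ : ∀ {R a b} {p p' q : Parent n} → p ≗ p' → Rot G R a b p q → Rot G R a b p' q
  Rot-respˡ p≗p' (st , pb≡a , qb≡pa , qa≡b , reattached , unchanged) =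
    IsSearchTree-resp p≗p' st , trans (sym (p≗p' _)) pb≡a , trans qb≡pa (p≗p' _) , qa≡b ,
    (λ c p'c≡b → let (to-a , to-b) = reattached c (trans (p≗p' c) p'c≡b) in
      (to-a ∘ Walk-map G (λ u (a≤u , u≢b) → Anc-resp (sym ∘ p≗p') a≤u , u≢b)) ,
      (λ ¬w → to-b (¬w ∘ Walk-map G (λ u (a≤u , u≢b) → Anc-resp p≗p' a≤u , u≢b)))) ,
    (λ u u≢a u≢b p'u≢b →
      trans (unchanged u u≢a u≢b (p'u≢b ∘ trans (sym (p≗p' u)))) (p≗p' u))

  RotSeq-respˡ : ∀ {R π} {p p' q : Parent n} → p ≗ p' → RotSeq G R p π q → RotSeq G R p' π q
  RotSeq-respˡ p≗p' (done st p≗q)   =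
    done (IsSearchTree-resp p≗p' st) (λ v → trans (sym (p≗p' v)) (p≗q v))
  RotSeq-respˡ p≗p' (step rot rest) = step (Rot-respˡ p≗p' rot) rest

  RotSeq-respʳ : ∀ {R π} {p q q' : Parent n} → q ≗ q' → RotSeq G R p π q → RotSeq G R p π q'
  RotSeq-respʳ q≗q' (done st p≗q)   = done st (λ v → trans (p≗q v) (q≗q' v))
  RotSeq-respʳ q≗q' (step rot rest) = step rot (RotSeq-respʳ q≗q' rest)

  RotSeq-target : ∀ {R π} {p q : Parent n} → RotSeq G R p π q → IsSearchTree G R q
  RotSeq-target (done st p≗q)   = IsSearchTree-resp p≗q st
  RotSeq-target (step _ rest) = RotSeq-target rest

both-∈? : (S : Subset n) (ab : Fin n × Fin n) → Dec (proj₁ ab ∈ S × proj₂ ab ∈ S)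
both-∈? S (a , b) = (a ∈? S) ×-dec (b ∈? S)

restrict-accept : ∀ {S : Subset n} {a b} π → a ∈ S → b ∈ S →
                  restrict S ((a , b) ∷ π) ≡ (a , b) ∷ restrict S π
restrict-accept {S = S} π a∈S b∈S = filter-accept (both-∈? S) {xs = π} (a∈S , b∈S)

restrict-reject : ∀ {S : Subset n} {a b} π → ¬ (a ∈ S × b ∈ S) →
                  restrict S ((a , b) ∷ π) ≡ restrict S π
restrict-reject {S = S} π ab∉S = filter-reject (both-∈? S) {xs = π} ab∉S

restrict-⊆ : ∀ {S R : Subset n} → S ⊆ R → ∀ π → restrict S (restrict R π) ≡ restrict S π
restrict-⊆ S⊆R [] = refl
restrict-⊆ {S = S} {R} S⊆R (x ∷ π) with both-∈? R x | both-∈? S x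
... | yes x∈R | yes x∈S = begin
  restrict S (restrict R (x ∷ π)) ≡⟨ cong (restrict S) (filter-accept (both-∈? R) x∈R) ⟩
  restrict S (x ∷ restrict R π)   ≡⟨ filter-accept (both-∈? S) x∈S ⟩
  x ∷ restrict S (restrict R π)   ≡⟨ cong (x ∷_) (restrict-⊆ S⊆R π) ⟩
  x ∷ restrict S π                ≡⟨ filter-accept (both-∈? S) x∈S ⟨
  restrict S (x ∷ π)              ∎
  where open ≡-Reasoning
... | yes x∈R | no x∉S = begin
  restrict S (restrict R (x ∷ π)) ≡⟨ cong (restrict S) (filter-accept (both-∈? R) x∈R) ⟩
  restrict S (x ∷ restrict R π)   ≡⟨ filter-reject (both-∈? S) x∉S ⟩
  restrict S (restrict R π)       ≡⟨ restrict-⊆ S⊆R π ⟩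
  restrict S π                    ≡⟨ filter-reject (both-∈? S) x∉S ⟨
  restrict S (x ∷ π)              ∎
  where open ≡-Reasoning
... | no x∉R | yes (a∈S , b∈S) = ⊥-elim (x∉R (S⊆R a∈S , S⊆R b∈S))
... | no x∉R | no x∉S = begin
  restrict S (restrict R (x ∷ π)) ≡⟨ cong (restrict S) (filter-reject (both-∈? R) x∉R) ⟩
  restrict S (restrict R π)       ≡⟨ restrict-⊆ S⊆R π ⟩
  restrict S π                    ≡⟨ filter-reject (both-∈? S) x∉S ⟨
  restrict S (x ∷ π)              ∎
  where open ≡-Reasoning

module _ {G : Graph n} where

  RotSeq-inside : ∀ {R π} {p q : Parent n} → RotSeq G R p π q →
                  All (λ (a , b) → a ∈ R × b ∈ R) π
  RotSeq-inside (done _ _)      = []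
  RotSeq-inside (step rot rest) = (Rotation.a∈R rot , Rotation.b∈R rot) ∷ RotSeq-inside rest

  restrict-RotSeq : ∀ {R π} {p q : Parent n} → RotSeq G R p π q → restrict R π ≡ π
  restrict-RotSeq {R} seq = filter-all (both-∈? R) (RotSeq-inside seq)

  RotSeq-delete : ∀ {R π v} {p q : Parent n} → Simplicial G R v → RotSeq G R p π q →
                  RotSeq G (R ─ ⁅ v ⁆) (delete v p) (restrict (R ─ ⁅ v ⁆) π) (delete v q)
  RotSeq-delete {v = v} simp (done st p≗q) =
    done (IsSearchTree-delete st simp) (delete-cong v p≗q)
  RotSeq-delete {R} {v = v} {p} {q} simp (step {a = a} {b} {π} rot rest) with a ≟ v | b ≟ v
  ... | no a≢v | no b≢v =
    subst (λ π' → RotSeq G R⁻ (delete v p) π' (delete v q))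
          (sym (restrict-accept π (x∈p∧x≢y⇒x∈p─⁅y⁆ (Rotation.a∈R rot) a≢v)
                                  (x∈p∧x≢y⇒x∈p─⁅y⁆ (Rotation.b∈R rot) b≢v)))
          (step (RotationDelete.rot⁻ rot simp a≢v b≢v) (RotSeq-delete simp rest))
    where R⁻ = R ─ ⁅ v ⁆
  ... | yes refl | _ =
    subst (λ π' → RotSeq G R⁻ (delete v p) π' (delete v q))
          (sym (restrict-reject π (λ (a∈ , _) → x∈p─⁅y⁆⇒x≢y a∈ refl)))
          (RotSeq-respˡ (sym ∘ RotationSimplicial.delete-upper rot simp) (RotSeq-delete simp rest))
    where R⁻ = R ─ ⁅ v ⁆
  ... | no _ | yes refl =
    subst (λ π' → RotSeq G R⁻ (delete v p) π' (delete v q))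
          (sym (restrict-reject {a = a} π (λ (_ , b∈) → x∈p─⁅y⁆⇒x≢y b∈ refl)))
          (RotSeq-respˡ (sym ∘ RotationSimplicial.delete-lower rot simp) (RotSeq-delete simp rest))
    where R⁻ = R ─ ⁅ v ⁆

  IsElim-⊆ : ∀ {R ℓ S} → IsElim G R ℓ S → S ⊆ R
  IsElim-⊆ done               u∈S = u∈S
  IsElim-⊆ (elim _ _ ℓ-elim) u∈S = x∈p─⁅y⁆⇒x∈p (IsElim-⊆ ℓ-elim u∈S)

  IsSearchTree-deleteAll : ∀ {R ℓ S p} → IsElim G R ℓ S → IsSearchTree G R p →
                           IsSearchTree G S (deleteAll ℓ p)
  IsSearchTree-deleteAll done               st = st
  IsSearchTree-deleteAll (elim _ simp ℓ-elim) st =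
    IsSearchTree-deleteAll ℓ-elim (IsSearchTree-delete st simp)

  RotSeq-deleteAll : ∀ {R ℓ S π} {p q : Parent n} → IsElim G R ℓ S → RotSeq G R p π q →
                     RotSeq G S (deleteAll ℓ p) (restrict S π) (deleteAll ℓ q)
  RotSeq-deleteAll {R} {p = p} {q} done seq =
    subst (λ π' → RotSeq G R p π' q) (sym (restrict-RotSeq seq)) seq
  RotSeq-deleteAll {S = S} {π} (elim _ simp ℓ-elim) seq =
    subst (λ π' → RotSeq G S _ π' _) (restrict-⊆ (IsElim-⊆ ℓ-elim) π)
      (RotSeq-deleteAll ℓ-elim (RotSeq-delete simp seq))

data NearestAncestorIn (S : Subset n) (p : Parent n) : Fin n → Maybe (Fin n) → Set where
  none   : ∀ {u} → p u ≡ nothing → NearestAncestorIn S p u nothing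
  parent : ∀ {u w} → p u ≡ just w → w ∈ S → NearestAncestorIn S p u (just w)
  skip   : ∀ {u w m} → p u ≡ just w → w ∉ S →
           NearestAncestorIn S p w m → NearestAncestorIn S p u m

NearestAncestorIn-functional : ∀ {S : Subset n} {p u m₁ m₂} →
  NearestAncestorIn S p u m₁ → NearestAncestorIn S p u m₂ → m₁ ≡ m₂
NearestAncestorIn-functional (none _) (none _) = refl
NearestAncestorIn-functional (none pu≡∅) (parent pu≡w _) =
  ⊥-elim (≡just⇒≢nothing pu≡w pu≡∅)
NearestAncestorIn-functional (none pu≡∅) (skip pu≡w _ _) =
  ⊥-elim (≡just⇒≢nothing pu≡w pu≡∅)
NearestAncestorIn-functional (parent pu≡w _) (none pu≡∅) =
  ⊥-elim (≡just⇒≢nothing pu≡w pu≡∅)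
NearestAncestorIn-functional (parent pu≡w _) (parent pu≡w' _) = trans (sym pu≡w) pu≡w'
NearestAncestorIn-functional (parent pu≡w w∈S) (skip pu≡w' w'∉S _)
  with just-injective (trans (sym pu≡w) pu≡w')
... | refl = ⊥-elim (w'∉S w∈S)
NearestAncestorIn-functional (skip pu≡w _ _) (none pu≡∅) =
  ⊥-elim (≡just⇒≢nothing pu≡w pu≡∅)
NearestAncestorIn-functional (skip pu≡w w∉S _) (parent pu≡w' w'∈S)
  with just-injective (trans (sym pu≡w) pu≡w')
... | refl = ⊥-elim (w∉S w'∈S)
NearestAncestorIn-functional (skip pu≡w _ r) (skip pu≡w' _ r')
  with just-injective (trans (sym pu≡w) pu≡w')
... | refl = NearestAncestorIn-functional r r'

module _ {G : Graph n} where

  NearestAncestorIn-parent : ∀ {R p} → IsSearchTree G R p → ∀ u →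
                             NearestAncestorIn R p u (p u)
  NearestAncestorIn-parent {p = p} st u with p u in pu
  ... | nothing = none pu
  ... | just w  = parent pu (SearchTree.parent-∈ st u w pu)

  NearestAncestorIn-delete : ∀ {R S p v} → IsSearchTree G R p → v ∉ S → ∀ {u m} → u ≢ v →
                             NearestAncestorIn S (delete v p) u m → NearestAncestorIn S p u m
  NearestAncestorIn-delete {p = p} {v} st v∉S {u} u≢v r with deleteView {v = v} {p} u | r
  ... | removed u≡v _    | _ = ⊥-elim (u≢v u≡v)
  ... | lifted _ pu≡v d | none e       = skip pu≡v v∉S (none (trans (sym d) e))
  ... | lifted _ pu≡v d | parent e w∈S = skip pu≡v v∉S (parent (trans (sym d) e) w∈S)
  ... | lifted _ pu≡v d | skip e w∉S r' =
    let pv≡w = trans (sym d) e in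
    skip pu≡v v∉S (skip pv≡w w∉S
      (NearestAncestorIn-delete st v∉S (SearchTree.parent-≢ st pv≡w) r'))
  ... | kept _ _ d       | none e       = none (trans (sym d) e)
  ... | kept _ _ d       | parent e w∈S = parent (trans (sym d) e) w∈S
  ... | kept _ pu≢v d    | skip e w∉S r' =
    let pu≡w = trans (sym d) e in
    skip pu≡w w∉S (NearestAncestorIn-delete st v∉S (≡just∧≢just⇒≢ pu≡w pu≢v) r')

  NearestAncestorIn-deleteAll : ∀ {R ℓ S p} → IsElim G R ℓ S → IsSearchTree G R p →
                                ∀ u → u ∈ S → NearestAncestorIn S p u (deleteAll ℓ p u)
  NearestAncestorIn-deleteAll done st u _ = NearestAncestorIn-parent st u
  NearestAncestorIn-deleteAll (elim _ simp ℓ-elim) st u u∈S =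
    NearestAncestorIn-delete st (λ v∈S → x∈p─⁅y⁆⇒x≢y (IsElim-⊆ ℓ-elim v∈S) refl)
      (x∈p─⁅y⁆⇒x≢y (IsElim-⊆ ℓ-elim u∈S))
      (NearestAncestorIn-deleteAll ℓ-elim (IsSearchTree-delete st simp) u u∈S)

  deleteAll-irrelevant : ∀ {R ℓ ℓ' S p} → IsElim G R ℓ S → IsElim G R ℓ' S →
                         IsSearchTree G R p → deleteAll ℓ p ≗ deleteAll ℓ' p
  deleteAll-irrelevant {S = S} ℓ-elim ℓ'-elim st u with u ∈? S
  ... | yes u∈S = NearestAncestorIn-functional (NearestAncestorIn-deleteAll ℓ-elim st u u∈S)
                                               (NearestAncestorIn-deleteAll ℓ'-elim st u u∈S)
  ... | no u∉S  = trans (SearchTree.outside-orphan (IsSearchTree-deleteAll ℓ-elim st) u u∉S)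
                        (sym (SearchTree.outside-orphan (IsSearchTree-deleteAll ℓ'-elim st) u u∉S))

lemma19 : ∀ {n} (G : Graph n) → Connected G (_∈ ⊤) → Chordal G →
    (T T' : Parent n) (π : List (Fin n × Fin n)) → RotSeq G ⊤ T π T' →
    (S : Subset n) (ℓ ℓ' : List (Fin n)) → IsElim G ⊤ ℓ S → IsElim G ⊤ ℓ' S →
    RotSeq G S (deleteAll ℓ T) (restrict S π) (deleteAll ℓ' T')
lemma19 G _ _ T T' π seq S ℓ ℓ' ℓ-elim ℓ'-elim =
  RotSeq-respʳ (deleteAll-irrelevant ℓ-elim ℓ'-elim (RotSeq-target seq))
               (RotSeq-deleteAll ℓ-elim seq)
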